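{- Let $M$ be a matroid, let $A$ and $B$ be disjoint subsets of $E(M)$, and let $a,b$ be distinct elements not in $E(M)$. Let $M_{\langle a\rangle}$ be obtained from $M$ by freely adding $a$ into the guts of $A$; $M_{\langle b\rangle}$ obtained from $M$ by freely adding $b$ into the guts of $B$; $M_{\langle a\rangle\langle b\rangle}$ obtained from $M_{\langle a\rangle}$ by freely adding $b$ into the guts of $B$; and $M_{\langle b\rangle\langle a\rangle}$ obtained from $M_{\langle b\rangle}$ by freely adding $a$ into the guts of $A$. Then $M_{\langle a\rangle\langle b\rangle}=M_{\langle b\rangle\langle a\rangle}$.
   Context: For a matroid $N$ with rank function $r$, $\lambda_N(X)=r(X)+r(E(N)-X)-r(N)$. Freely adding $e\notin E(N)$ into the guts of $Z\subseteq E(N)$: the single-element extension $N'$ of $N$ by $e$ such that, for each $X\subseteq E(N)$, $r_{N'}(X\cup\{e\})=r_N(X)$ if $\lambda_{N/X}(Z-X)=0$ and $r_{N'}(X\cup\{e\})=r_N(X)+1$ otherwise. -}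

module Defs where

open import Data.Nat using (ℕ; suc; _+_; _∸_; _≤_)
open import Data.Fin using (Fin)
open import Data.Fin.Subset using (Subset; _∈_; _∉_; _⊆_; _∪_; _∩_; _─_; ⁅_⁆; ∣_∣)
open import Data.Product using (_×_)
open import Relation.Binary.PropositionalEquality using (_≡_; _≢_)

-- The values of r outside subsets of E are irrelevant.
record Matroid (m : ℕ) : Set where
  field
    E  : Subset m
    r  : Subset m → ℕ
    R1 : ∀ X → X ⊆ E → r X ≤ ∣ X ∣
    R2 : ∀ X Y → X ⊆ Y → Y ⊆ E → r X ≤ r Y
    R3 : ∀ X Y → X ⊆ E → Y ⊆ E → r (X ∪ Y) + r (X ∩ Y) ≤ r X + r Y

open Matroid public

contractRank : ∀ {m} → Matroid m → Subset m → Subset m → ℕ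
contractRank N X Y = r N (Y ∪ X) ∸ r N X

-- Connectivity function of the contraction N / X:
-- λ_{N/X}(Y) = r_{N/X}(Y) + r_{N/X}(E(N/X) − Y) − r(N/X),
-- where E(N/X) = E(N) − X and r(N/X) = r_{N/X}(E(N/X)).
-- (For a matroid all subtractions here are truncation-free.)
λContract : ∀ {m} → Matroid m → Subset m → Subset m → ℕ
λContract N X Y =
  contractRank N X Y + contractRank N X ((E N ─ X) ─ Y) ∸ contractRank N X (E N ─ X)

FreeGutsExt : ∀ {m} → Matroid m → Subset m → Fin m → Matroid m → Set
FreeGutsExt N Z e N' =
  (e ∉ E N) × (Z ⊆ E N) × (E N' ≡ E N ∪ ⁅ e ⁆) ×
  (∀ X → X ⊆ E N → r N' X ≡ r N X) ×
  (∀ X → X ⊆ E N →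
     (λContract N X (Z ─ X) ≡ 0 → r N' (X ∪ ⁅ e ⁆) ≡ r N X) ×
     (λContract N X (Z ─ X) ≢ 0 → r N' (X ∪ ⁅ e ⁆) ≡ suc (r N X)))

_≈M_ : ∀ {m} → Matroid m → Matroid m → Set
M ≈M N = (E M ≡ E N) × (∀ X → X ⊆ E M → r M X ≡ r N X)

{-# OPTIONS --safe #-}

-- Freely adding e into the guts of Z raises the rank of X ⊆ E(N) by 1 ⊓ λ_{N/X}(Z − X), and
-- leaves λ_{N/X}(W − X) unchanged when W is disjoint from Z.  Hence adding a and b in either
-- order gives the same rank on X, X ∪ a and X ∪ b.  For X ∪ {a, b}, the splittings
-- λ_{M/X}(A) = λ_{M/(X ∪ B)}(A) + κ and λ_{M/X}(B) = λ_{M/(X ∪ A)}(B) + κ, where κ is the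
-- local connectivity of A and B in M/X, show that the rank rises by
-- 2 ⊓ (1 ⊓ λ_{M/(X ∪ B)}(A) + 1 ⊓ λ_{M/(X ∪ A)}(B) + κ), which is symmetric in (A, a) and (B, b).

module Submission where

open import Defs
open import Data.Nat using (ℕ)
open import Data.Fin using (Fin)
open import Data.Fin.Subset using (Subset; ⊥; _∉_; _⊆_; _∩_)
open import Relation.Binary.PropositionalEquality using (_≡_; _≢_)

open import Algebra.Bundles using (CommutativeMonoid)
import Algebra.Properties.CommutativeSemigroup as CommutativeSemigroupProperties
open import Data.Fin.Subset using (_∈_; _∪_; _─_; _-_; ⁅_⁆; inside; outside)
open import Data.Fin.Subset.Properties
  using (_∈?_; ∉⊥; ⊥⊆; ⊆-refl; ⊆-trans; ⊆-antisym; x∈⁅y⁆⇒x≡y; p⊆p∪q; q⊆p∪q; x∈p∪q⁻;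
         p∩q⊆p; x∈p∩q⁺; x∈p∧x∉q⇒x∈p─q; p─q⊆p; drop-there; p─⊥≡p; ∪-comm; ∪-assoc; ∪-idem;
         ∪-identityˡ; ∩-comm; ∪-commutativeMonoid)
open import Data.Nat using (zero; suc; _+_; _∸_; _≤_; _⊓_)
open import Data.Nat.Properties
  using (+-identityʳ; +-suc; +-comm; +-assoc; +-mono-≤; ≤-trans; n∸n≡0; m≤n⇒∃[o]m+o≡n;
         m+n∸m≡n; m+[n∸m]≡n; +-cancelˡ-≤; +-cancelˡ-≡; +-cancelʳ-≡)
open import Data.Nat.Tactic.RingSolver using (solve-∀)
open import Data.Product using (_,_; proj₁; proj₂)
open import Data.Sum using ([_,_]′)
open import Data.Vec using ([]; _∷_; here; there)
open import Function using (_∘_; id)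
open import Relation.Nullary using (yes; no; contradiction)
open import Relation.Binary.PropositionalEquality
  using (refl; sym; trans; cong; cong₂; subst; subst₂; module ≡-Reasoning)

private
  variable
    m : ℕ
    p q s A B S W X Y Z : Subset m
    i e : Fin m

open module ∪-Properties {m : ℕ} =
  CommutativeSemigroupProperties (CommutativeMonoid.commutativeSemigroup (∪-commutativeMonoid m))
  using ()
  renaming (xy∙z≈xz∙y to [p∪q]∪s≡[p∪s]∪q; x∙yz≈y∙xz to p∪[q∪s]≡q∪[p∪s];
            interchange to ∪-interchange)

∪-lub : p ⊆ s → q ⊆ s → p ∪ q ⊆ s
∪-lub {p = p} {q = q} p⊆s q⊆s i∈p∪q = [ p⊆s , q⊆s ]′ (x∈p∪q⁻ p q i∈p∪q)

x∈p∪q∧x∉q⇒x∈p : i ∈ p ∪ q → i ∉ q → i ∈ p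
x∈p∪q∧x∉q⇒x∈p {p = p} {q = q} i∈p∪q i∉q =
  [ id , (λ i∈q → contradiction i∈q i∉q) ]′ (x∈p∪q⁻ p q i∈p∪q)

x∈p─q⇒x∉q : ∀ (p q : Subset m) → i ∈ p ─ q → i ∉ q
x∈p─q⇒x∉q (inside  ∷ p) (outside ∷ q) here        = λ ()
x∈p─q⇒x∉q (inside  ∷ p) (outside ∷ q) (there i∈) = x∈p─q⇒x∉q p q i∈ ∘ drop-there
x∈p─q⇒x∉q (outside ∷ p) (outside ∷ q) (there i∈) = x∈p─q⇒x∉q p q i∈ ∘ drop-there
x∈p─q⇒x∉q (_       ∷ p) (inside  ∷ q) (there i∈) = x∈p─q⇒x∉q p q i∈ ∘ drop-there

p⊆q∧p∩s≡⊥⇒p⊆q─s : p ⊆ q → p ∩ s ≡ ⊥ → p ⊆ q ─ s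
p⊆q∧p∩s≡⊥⇒p⊆q─s p⊆q p∩s≡⊥ i∈p =
  x∈p∧x∉q⇒x∈p─q (p⊆q i∈p) (λ i∈s → ∉⊥ (subst (_ ∈_) p∩s≡⊥ (x∈p∩q⁺ (i∈p , i∈s))))

p⊆q⇒p∪q≡q : p ⊆ q → p ∪ q ≡ q
p⊆q⇒p∪q≡q {p = p} {q = q} p⊆q = ⊆-antisym (∪-lub p⊆q ⊆-refl) (q⊆p∪q p q)

p⊆q⇒p─q≡⊥ : p ⊆ q → p ─ q ≡ ⊥
p⊆q⇒p─q≡⊥ {p = p} {q = q} p⊆q =
  ⊆-antisym (λ i∈p─q → contradiction (p⊆q (p─q⊆p p q i∈p─q)) (x∈p─q⇒x∉q p q i∈p─q)) ⊥⊆

[p─q]∪q≡p∪q : ∀ (p q : Subset m) → (p ─ q) ∪ q ≡ p ∪ q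
[p─q]∪q≡p∪q []            []            = refl
[p─q]∪q≡p∪q (_       ∷ p) (outside ∷ q) = cong (_ ∷_) ([p─q]∪q≡p∪q p q)
[p─q]∪q≡p∪q (inside  ∷ p) (inside  ∷ q) = cong (inside ∷_) ([p─q]∪q≡p∪q p q)
[p─q]∪q≡p∪q (outside ∷ p) (inside  ∷ q) = cong (inside ∷_) ([p─q]∪q≡p∪q p q)

q⊆p⇒[p─q]∪q≡p : q ⊆ p → (p ─ q) ∪ q ≡ p
q⊆p⇒[p─q]∪q≡p {q = q} {p = p} q⊆p =
  trans ([p─q]∪q≡p∪q p q) (trans (∪-comm p q) (p⊆q⇒p∪q≡q q⊆p))

[p─s]─[q─s]∪s≡[p─q]∪s : ∀ (p q s : Subset m) → ((p ─ s) ─ (q ─ s)) ∪ s ≡ (p ─ q) ∪ s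
[p─s]─[q─s]∪s≡[p─q]∪s []            []            []            = refl
[p─s]─[q─s]∪s≡[p─q]∪s (_       ∷ p) (_       ∷ q) (outside ∷ s) =
  cong (_ ∷_) ([p─s]─[q─s]∪s≡[p─q]∪s p q s)
[p─s]─[q─s]∪s≡[p─q]∪s (_       ∷ p) (inside  ∷ q) (inside  ∷ s) =
  cong (inside ∷_) ([p─s]─[q─s]∪s≡[p─q]∪s p q s)
[p─s]─[q─s]∪s≡[p─q]∪s (inside  ∷ p) (outside ∷ q) (inside  ∷ s) =
  cong (inside ∷_) ([p─s]─[q─s]∪s≡[p─q]∪s p q s)
[p─s]─[q─s]∪s≡[p─q]∪s (outside ∷ p) (outside ∷ q) (inside  ∷ s) =
  cong (inside ∷_) ([p─s]─[q─s]∪s≡[p─q]∪s p q s)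

─-distribʳ-∪ : ∀ (p q s : Subset m) → (p ∪ q) ─ s ≡ (p ─ s) ∪ (q ─ s)
─-distribʳ-∪ []      []      []            = refl
─-distribʳ-∪ (_ ∷ p) (_ ∷ q) (inside  ∷ s) = cong (outside ∷_) (─-distribʳ-∪ p q s)
─-distribʳ-∪ (_ ∷ p) (_ ∷ q) (outside ∷ s) = cong (_ ∷_) (─-distribʳ-∪ p q s)

x∉p⇒⁅x⁆─p≡⁅x⁆ : i ∉ p → ⁅ i ⁆ ─ p ≡ ⁅ i ⁆
x∉p⇒⁅x⁆─p≡⁅x⁆ {i = i} {p = p} i∉p = ⊆-antisym (p─q⊆p ⁅ i ⁆ p) λ j∈⁅i⁆ →
  x∈p∧x∉q⇒x∈p─q j∈⁅i⁆ (subst (_∉ p) (sym (x∈⁅y⁆⇒x≡y i j∈⁅i⁆)) i∉p)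

x∈p⇒[p-x]∪⁅x⁆≡p : i ∈ p → (p - i) ∪ ⁅ i ⁆ ≡ p
x∈p⇒[p-x]∪⁅x⁆≡p {i = i} i∈p =
  q⊆p⇒[p─q]∪q≡p (λ j∈⁅i⁆ → subst (_∈ _) (sym (x∈⁅y⁆⇒x≡y i j∈⁅i⁆)) i∈p)

data Split {m} (S : Subset m) (e : Fin m) : Subset m → Set where
  absent  : X ⊆ S → Split S e X
  present : X ⊆ S → Split S e (X ∪ ⁅ e ⁆)

split : X ⊆ S ∪ ⁅ e ⁆ → Split S e X
split {X = X} {S = S} {e = e} X⊆S∪e with e ∈? X
... | no e∉X = absent λ i∈X →
  x∈p∪q∧x∉q⇒x∈p (X⊆S∪e i∈X) (λ i∈⁅e⁆ → e∉X (subst (_∈ X) (x∈⁅y⁆⇒x≡y e i∈⁅e⁆) i∈X))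
... | yes e∈X = subst (Split S e) (x∈p⇒[p-x]∪⁅x⁆≡p e∈X) (present λ i∈X-e →
  x∈p∪q∧x∉q⇒x∈p (X⊆S∪e (p─q⊆p X ⁅ e ⁆ i∈X-e)) (x∈p─q⇒x∉q X ⁅ e ⁆ i∈X-e))

∸-relative-sum : ∀ {x a c e} → x ≤ a → x ≤ c → x ≤ e → e + x ≤ a + c →
                 a + c ≡ x + e + ((a ∸ x) + (c ∸ x) ∸ (e ∸ x))
∸-relative-sum {x} x≤a x≤c x≤e e+x≤a+c
  with a′ , refl ← m≤n⇒∃[o]m+o≡n x≤a
     | c′ , refl ← m≤n⇒∃[o]m+o≡n x≤c
     | e′ , refl ← m≤n⇒∃[o]m+o≡n x≤e
  rewrite m+n∸m≡n x a′ | m+n∸m≡n x c′ | m+n∸m≡n x e′ = begin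
    x + a′ + (x + c′)              ≡⟨ regroup x a′ c′ ⟩
    x + x + (a′ + c′)              ≡⟨ cong (x + x +_) (m+[n∸m]≡n e′≤a′+c′) ⟨
    x + x + (e′ + (a′ + c′ ∸ e′))  ≡⟨ reassociate x e′ (a′ + c′ ∸ e′) ⟩
    x + (x + e′) + (a′ + c′ ∸ e′)  ∎
  where
  open ≡-Reasoning
  regroup : ∀ x a c → x + a + (x + c) ≡ x + x + (a + c)
  regroup = solve-∀
  reassociate : ∀ x e k → x + x + (e + k) ≡ x + (x + e) + k
  reassociate = solve-∀
  swap : ∀ x e → x + e + x ≡ x + x + e
  swap = solve-∀
  e′≤a′+c′ : e′ ≤ a′ + c′
  e′≤a′+c′ = +-cancelˡ-≤ (x + x) _ _ (subst₂ _≤_ (swap x e′) (regroup x a′ c′) e+x≤a+c)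

stepwise-rise : ∀ p q d l → l + 1 ⊓ (p + d) ≡ q + d + 1 ⊓ p →
                1 ⊓ (p + d) + 1 ⊓ l ≡ 2 ⊓ (1 ⊓ p + 1 ⊓ q + d)
stepwise-rise (suc p) zero    d       l eq with refl ← +-cancelʳ-≡ 1 l d eq = refl
stepwise-rise (suc p) (suc q) d       l eq with refl ← +-cancelʳ-≡ 1 l (suc q + d) eq = refl
stepwise-rise zero    zero    zero    l eq with refl ← +-cancelʳ-≡ 0 l 0 eq = refl
stepwise-rise zero    (suc q) zero    l eq with refl ← +-cancelʳ-≡ 0 l (suc q + 0) eq = refl
stepwise-rise zero    zero    (suc d) l eq
  with refl ← +-cancelʳ-≡ 1 l d (trans eq (trans (+-identityʳ (suc d)) (+-comm 1 d))) = refl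
stepwise-rise zero    (suc q) (suc d) l eq
  with refl ← +-cancelʳ-≡ 1 l (suc q + d)
                (trans eq (trans (+-identityʳ _) (trans (+-suc (suc q) d) (+-comm 1 (suc q + d)))))
  = refl

conn : Matroid m → Subset m → Subset m → ℕ
conn N X Z = λContract N X (Z ─ X)

localConn : Matroid m → Subset m → Subset m → Subset m → ℕ
localConn N X A B = r N (A ∪ X) + r N (B ∪ X) ∸ (r N (A ∪ B ∪ X) + r N X)

jointRise : Matroid m → Subset m → Subset m → Subset m → ℕ
jointRise N X A B = 2 ⊓ (1 ⊓ conn N (B ∪ X) A + 1 ⊓ conn N (A ∪ X) B + localConn N X A B)

submodular-⊆ : (N : Matroid m) → A ⊆ E N → B ⊆ E N → S ⊆ A ∩ B → W ⊆ A ∪ B →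
               r N W + r N S ≤ r N A + r N B
submodular-⊆ {A = A} {B = B} N A⊆E B⊆E S⊆A∩B W⊆A∪B =
  ≤-trans (+-mono-≤ (R2 N _ _ W⊆A∪B (∪-lub A⊆E B⊆E))
                    (R2 N _ _ S⊆A∩B (⊆-trans (p∩q⊆p A B) A⊆E)))
          (R3 N A B A⊆E B⊆E)

conn-⊇ : (N : Matroid m) → Z ⊆ X → conn N X Z ≡ 0
conn-⊇ {Z = Z} {X = X} N Z⊆X = begin
  conn N X Z               ≡⟨ cong (λContract N X) (p⊆q⇒p─q≡⊥ Z⊆X) ⟩
  λContract N X ⊥          ≡⟨ cong₂ (λ S T → (r N S ∸ r N X) + (r N (T ∪ X) ∸ r N X) ∸ c)
                                    (∪-identityˡ X) (p─⊥≡p (E N ─ X)) ⟩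
  (r N X ∸ r N X) + c ∸ c  ≡⟨ cong (λ k → k + c ∸ c) (n∸n≡0 (r N X)) ⟩
  c ∸ c                    ≡⟨ n∸n≡0 c ⟩
  0                        ∎
  where
  open ≡-Reasoning
  c = contractRank N X (E N ─ X)

conn-spec : (N : Matroid m) → Z ⊆ E N → X ⊆ E N →
            r N (Z ∪ X) + r N ((E N ─ Z) ∪ X) ≡ r N X + r N (E N) + conn N X Z
conn-spec {Z = Z} {X = X} N Z⊆E X⊆E = begin
  r N (Z ∪ X) + r N ((E N ─ Z) ∪ X)
    ≡⟨ ∸-relative-sum (R2 N _ _ (q⊆p∪q Z X) Z∪X⊆E) (R2 N _ _ (q⊆p∪q (E N ─ Z) X) [E─Z]∪X⊆E)
                      (R2 N _ _ X⊆E ⊆-refl) (submodular-⊆ N Z∪X⊆E [E─Z]∪X⊆E X⊆∩ E⊆∪) ⟩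
  r N X + r N (E N) + relative (Z ∪ X) ((E N ─ Z) ∪ X) (E N)
    ≡⟨ cong (r N X + r N (E N) +_) unfold ⟨
  r N X + r N (E N) + conn N X Z
    ∎
  where
  open ≡-Reasoning
  relative : Subset _ → Subset _ → Subset _ → ℕ
  relative S T U = (r N S ∸ r N X) + (r N T ∸ r N X) ∸ (r N U ∸ r N X)

  unfold : conn N X Z ≡ relative (Z ∪ X) ((E N ─ Z) ∪ X) (E N)
  unfold = begin
    conn N X Z
      ≡⟨ cong₂ (λ S T → relative S T ((E N ─ X) ∪ X))
               ([p─q]∪q≡p∪q Z X) ([p─s]─[q─s]∪s≡[p─q]∪s (E N) Z X) ⟩
    relative (Z ∪ X) ((E N ─ Z) ∪ X) ((E N ─ X) ∪ X)
      ≡⟨ cong (relative _ _) (q⊆p⇒[p─q]∪q≡p X⊆E) ⟩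
    relative (Z ∪ X) ((E N ─ Z) ∪ X) (E N)
      ∎

  Z∪X⊆E : Z ∪ X ⊆ E N
  Z∪X⊆E = ∪-lub Z⊆E X⊆E
  [E─Z]∪X⊆E : (E N ─ Z) ∪ X ⊆ E N
  [E─Z]∪X⊆E = ∪-lub (p─q⊆p (E N) Z) X⊆E
  X⊆∩ : X ⊆ (Z ∪ X) ∩ ((E N ─ Z) ∪ X)
  X⊆∩ i∈X = x∈p∩q⁺ (q⊆p∪q Z X i∈X , q⊆p∪q (E N ─ Z) X i∈X)
  E⊆∪ : E N ⊆ (Z ∪ X) ∪ ((E N ─ Z) ∪ X)
  E⊆∪ {i} i∈E with i ∈? Z
  ... | yes i∈Z = p⊆p∪q _ (p⊆p∪q X i∈Z)
  ... | no  i∉Z = q⊆p∪q (Z ∪ X) _ (p⊆p∪q X (x∈p∧x∉q⇒x∈p─q i∈E i∉Z))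

localConn-spec : (N : Matroid m) → A ⊆ E N → B ⊆ E N → X ⊆ E N →
                 r N (A ∪ X) + r N (B ∪ X) ≡ r N (A ∪ B ∪ X) + r N X + localConn N X A B
localConn-spec {A = A} {B = B} {X = X} N A⊆E B⊆E X⊆E = sym (m+[n∸m]≡n
  (submodular-⊆ N (∪-lub A⊆E X⊆E) (∪-lub B⊆E X⊆E)
     (λ i∈X → x∈p∩q⁺ (q⊆p∪q A X i∈X , q⊆p∪q B X i∈X))
     (∪-lub (p⊆p∪q _ ∘ p⊆p∪q X) (q⊆p∪q (A ∪ X) (B ∪ X)))))

localConn-comm : (N : Matroid m) (X A B : Subset m) → localConn N X A B ≡ localConn N X B A
localConn-comm N X A B =
  cong₂ (λ k S → k ∸ (r N S + r N X)) (+-comm (r N (A ∪ X)) _) (p∪[q∪s]≡q∪[p∪s] A B X)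

jointRise-comm : (N : Matroid m) (X A B : Subset m) → jointRise N X A B ≡ jointRise N X B A
jointRise-comm N X A B =
  cong₂ (λ k l → 2 ⊓ (k + l)) (+-comm (1 ⊓ conn N (B ∪ X) A) _) (localConn-comm N X A B)

conn-split : (N : Matroid m) → A ⊆ E N → B ⊆ E N → B ∩ A ≡ ⊥ → X ⊆ E N →
             conn N X A ≡ conn N (B ∪ X) A + localConn N X A B
conn-split {A = A} {B = B} {X = X} N A⊆E B⊆E B∩A≡⊥ X⊆E = +-cancelˡ-≡ K _ _ (begin
  K + conn N X A              ≡⟨ shuffle₁ x ε rAB rB (conn N X A) ⟩
  (x + ε + conn N X A) + (rAB + rB)
                              ≡⟨ cong (_+ (rAB + rB)) (conn-spec N A⊆E X⊆E) ⟨
  (rA + cA) + (rAB + rB)      ≡⟨ shuffle₂ rA cA rAB rB ⟩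
  (rA + rB) + (rAB + cA)      ≡⟨ cong₂ _+_ (localConn-spec N A⊆E B⊆E X⊆E) over-B∪X ⟩
  (rAB + x + D) + (rB + ε + P)  ≡⟨ shuffle₃ rAB x D rB ε P ⟩
  K + (P + D)                 ∎)
  where
  open ≡-Reasoning
  x = r N X ; ε = r N (E N) ; rA = r N (A ∪ X) ; rB = r N (B ∪ X) ; rAB = r N (A ∪ B ∪ X)
  cA = r N ((E N ─ A) ∪ X) ; P = conn N (B ∪ X) A ; D = localConn N X A B
  K = x + ε + rAB + rB

  absorb-B : (E N ─ A) ∪ B ∪ X ≡ (E N ─ A) ∪ X
  absorb-B = begin
    (E N ─ A) ∪ B ∪ X    ≡⟨ ∪-assoc (E N ─ A) B X ⟨
    ((E N ─ A) ∪ B) ∪ X  ≡⟨ cong (_∪ X) (trans (∪-comm _ B)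
                                         (p⊆q⇒p∪q≡q (p⊆q∧p∩s≡⊥⇒p⊆q─s B⊆E B∩A≡⊥))) ⟩
    (E N ─ A) ∪ X        ∎

  over-B∪X : rAB + cA ≡ rB + ε + P
  over-B∪X = begin
    rAB + cA                       ≡⟨ cong (λ S → rAB + r N S) absorb-B ⟨
    rAB + r N ((E N ─ A) ∪ B ∪ X)  ≡⟨ conn-spec N A⊆E (∪-lub B⊆E X⊆E) ⟩
    rB + ε + P                     ∎

  shuffle₁ : ∀ x ε ab b g → x + ε + ab + b + g ≡ (x + ε + g) + (ab + b)
  shuffle₁ = solve-∀
  shuffle₂ : ∀ a c ab b → (a + c) + (ab + b) ≡ (a + b) + (ab + c)
  shuffle₂ = solve-∀
  shuffle₃ : ∀ ab x d b ε p → (ab + x + d) + (b + ε + p) ≡ x + ε + ab + b + (p + d)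
  shuffle₃ = solve-∀

module FreeGutsExtension {m} (N N′ : Matroid m) {Z : Subset m} {e : Fin m}
                         (ext : FreeGutsExt N Z e N′) where
  open ≡-Reasoning

  e∉E : e ∉ E N
  e∉E = proj₁ ext

  Z⊆E : Z ⊆ E N
  Z⊆E = proj₁ (proj₂ ext)

  ground : E N′ ≡ E N ∪ ⁅ e ⁆
  ground = proj₁ (proj₂ (proj₂ ext))

  rank-old : X ⊆ E N → r N′ X ≡ r N X
  rank-old = proj₁ (proj₂ (proj₂ (proj₂ ext))) _

  -- The with-abstraction of conn N X Z also rewrites the guts condition supplied by ext.
  rank-adjoin : X ⊆ E N → r N′ (X ∪ ⁅ e ⁆) ≡ r N X + 1 ⊓ conn N X Z
  rank-adjoin {X = X} X⊆E with conn N X Z | proj₂ (proj₂ (proj₂ (proj₂ ext))) X X⊆E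
  ... | zero  | if-zero , _    = trans (if-zero refl) (sym (+-identityʳ (r N X)))
  ... | suc _ | _ , if-nonzero = trans (if-nonzero λ ()) (+-comm 1 (r N X))

  rank-adjoin-⊇ : Y ⊆ E N → Z ⊆ Y → r N′ (Y ∪ ⁅ e ⁆) ≡ r N Y
  rank-adjoin-⊇ {Y = Y} Y⊆E Z⊆Y = begin
    r N′ (Y ∪ ⁅ e ⁆)        ≡⟨ rank-adjoin Y⊆E ⟩
    r N Y + 1 ⊓ conn N Y Z  ≡⟨ cong (λ k → r N Y + 1 ⊓ k) (conn-⊇ N Z⊆Y) ⟩
    r N Y + 0               ≡⟨ +-identityʳ (r N Y) ⟩
    r N Y                   ∎

  rank-ground : r N′ (E N′) ≡ r N (E N)
  rank-ground = trans (cong (r N′) ground) (rank-adjoin-⊇ ⊆-refl Z⊆E)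

  ⊆-ext : X ⊆ E N → X ⊆ E N′
  ⊆-ext X⊆E = subst (_ ⊆_) (sym ground) (p⊆p∪q ⁅ e ⁆ ∘ X⊆E)

  ∪⁅e⁆⊆-ext : X ⊆ E N → X ∪ ⁅ e ⁆ ⊆ E N′
  ∪⁅e⁆⊆-ext X⊆E = subst (_ ⊆_) (sym ground) (∪-lub (p⊆p∪q ⁅ e ⁆ ∘ X⊆E) (q⊆p∪q (E N) ⁅ e ⁆))

  complement-ext : W ⊆ E N → E N′ ─ W ≡ (E N ─ W) ∪ ⁅ e ⁆
  complement-ext {W = W} W⊆E = begin
    E N′ ─ W                 ≡⟨ cong (_─ W) ground ⟩
    (E N ∪ ⁅ e ⁆) ─ W        ≡⟨ ─-distribʳ-∪ (E N) ⁅ e ⁆ W ⟩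
    (E N ─ W) ∪ (⁅ e ⁆ ─ W)  ≡⟨ cong ((E N ─ W) ∪_) (x∉p⇒⁅x⁆─p≡⁅x⁆ (e∉E ∘ W⊆E)) ⟩
    (E N ─ W) ∪ ⁅ e ⁆        ∎

  rank-complement-⊇ : W ⊆ E N → Z ∩ W ≡ ⊥ → X ⊆ E N →
                      r N′ (((E N ─ W) ∪ X) ∪ ⁅ e ⁆) ≡ r N ((E N ─ W) ∪ X)
  rank-complement-⊇ {W = W} {X = X} W⊆E Z∩W≡⊥ X⊆E =
    rank-adjoin-⊇ (∪-lub (p─q⊆p (E N) W) X⊆E) (p⊆p∪q X ∘ p⊆q∧p∩s≡⊥⇒p⊆q─s Z⊆E Z∩W≡⊥)

  rank-complement : W ⊆ E N → Z ∩ W ≡ ⊥ → X ⊆ E N →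
                    r N′ ((E N′ ─ W) ∪ X) ≡ r N ((E N ─ W) ∪ X)
  rank-complement {W = W} {X = X} W⊆E Z∩W≡⊥ X⊆E = begin
    r N′ ((E N′ ─ W) ∪ X)           ≡⟨ cong (λ S → r N′ (S ∪ X)) (complement-ext W⊆E) ⟩
    r N′ (((E N ─ W) ∪ ⁅ e ⁆) ∪ X)  ≡⟨ cong (r N′) ([p∪q]∪s≡[p∪s]∪q (E N ─ W) ⁅ e ⁆ X) ⟩
    r N′ (((E N ─ W) ∪ X) ∪ ⁅ e ⁆)  ≡⟨ rank-complement-⊇ W⊆E Z∩W≡⊥ X⊆E ⟩
    r N ((E N ─ W) ∪ X)             ∎

  rank-complement-adjoin : W ⊆ E N → Z ∩ W ≡ ⊥ → X ⊆ E N →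
                           r N′ ((E N′ ─ W) ∪ (X ∪ ⁅ e ⁆)) ≡ r N ((E N ─ W) ∪ X)
  rank-complement-adjoin {W = W} {X = X} W⊆E Z∩W≡⊥ X⊆E = begin
    r N′ ((E N′ ─ W) ∪ (X ∪ ⁅ e ⁆))
      ≡⟨ cong (λ S → r N′ (S ∪ (X ∪ ⁅ e ⁆))) (complement-ext W⊆E) ⟩
    r N′ (((E N ─ W) ∪ ⁅ e ⁆) ∪ (X ∪ ⁅ e ⁆))
      ≡⟨ cong (r N′) (∪-interchange (E N ─ W) ⁅ e ⁆ X ⁅ e ⁆) ⟩
    r N′ (((E N ─ W) ∪ X) ∪ (⁅ e ⁆ ∪ ⁅ e ⁆))
      ≡⟨ cong (λ S → r N′ (((E N ─ W) ∪ X) ∪ S)) (∪-idem ⁅ e ⁆) ⟩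
    r N′ (((E N ─ W) ∪ X) ∪ ⁅ e ⁆)
      ≡⟨ rank-complement-⊇ W⊆E Z∩W≡⊥ X⊆E ⟩
    r N ((E N ─ W) ∪ X)
      ∎

  conn-old : W ⊆ E N → Z ∩ W ≡ ⊥ → X ⊆ E N → conn N′ X W ≡ conn N X W
  conn-old {W = W} {X = X} W⊆E Z∩W≡⊥ X⊆E = +-cancelˡ-≡ (r N X + r N (E N)) _ _ (begin
    r N X + r N (E N) + conn N′ X W
      ≡⟨ cong₂ (λ k l → k + l + conn N′ X W) (rank-old X⊆E) rank-ground ⟨
    r N′ X + r N′ (E N′) + conn N′ X W
      ≡⟨ conn-spec N′ (⊆-ext W⊆E) (⊆-ext X⊆E) ⟨
    r N′ (W ∪ X) + r N′ ((E N′ ─ W) ∪ X)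
      ≡⟨ cong₂ _+_ (rank-old (∪-lub W⊆E X⊆E)) (rank-complement W⊆E Z∩W≡⊥ X⊆E) ⟩
    r N (W ∪ X) + r N ((E N ─ W) ∪ X)
      ≡⟨ conn-spec N W⊆E X⊆E ⟩
    r N X + r N (E N) + conn N X W
      ∎)

  conn-adjoin : W ⊆ E N → Z ∩ W ≡ ⊥ → X ⊆ E N →
                conn N′ (X ∪ ⁅ e ⁆) W + 1 ⊓ conn N X Z ≡ conn N X W + 1 ⊓ conn N (W ∪ X) Z
  conn-adjoin {W = W} {X = X} W⊆E Z∩W≡⊥ X⊆E = +-cancelˡ-≡ (x + ε) _ _ (begin
    x + ε + (l + c)
      ≡⟨ shuffle₁ x ε l c ⟩
    x + c + ε + l
      ≡⟨ cong₂ (λ k k′ → k + k′ + l) (rank-adjoin X⊆E) rank-ground ⟨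
    r N′ (X ∪ ⁅ e ⁆) + r N′ (E N′) + l
      ≡⟨ conn-spec N′ (⊆-ext W⊆E) (∪⁅e⁆⊆-ext X⊆E) ⟨
    r N′ (W ∪ X ∪ ⁅ e ⁆) + r N′ ((E N′ ─ W) ∪ X ∪ ⁅ e ⁆)
      ≡⟨ cong₂ _+_ rank-W∪X∪e (rank-complement-adjoin W⊆E Z∩W≡⊥ X⊆E) ⟩
    r N (W ∪ X) + c′ + r N ((E N ─ W) ∪ X)
      ≡⟨ shuffle₂ (r N (W ∪ X)) c′ _ ⟩
    r N (W ∪ X) + r N ((E N ─ W) ∪ X) + c′
      ≡⟨ cong (_+ c′) (conn-spec N W⊆E X⊆E) ⟩
    x + ε + conn N X W + c′
      ≡⟨ +-assoc (x + ε) _ c′ ⟩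
    x + ε + (conn N X W + c′)
      ∎)
    where
    x = r N X ; ε = r N (E N) ; l = conn N′ (X ∪ ⁅ e ⁆) W
    c = 1 ⊓ conn N X Z ; c′ = 1 ⊓ conn N (W ∪ X) Z

    rank-W∪X∪e : r N′ (W ∪ X ∪ ⁅ e ⁆) ≡ r N (W ∪ X) + c′
    rank-W∪X∪e = trans (cong (r N′) (sym (∪-assoc W X ⁅ e ⁆))) (rank-adjoin (∪-lub W⊆E X⊆E))

    shuffle₁ : ∀ x ε l c → x + ε + (l + c) ≡ x + c + ε + l
    shuffle₁ = solve-∀
    shuffle₂ : ∀ a c b → a + c + b ≡ a + b + c
    shuffle₂ = solve-∀

module TwoExtensions {m} (M Ma Mab : Matroid m) {A B : Subset m} {a b : Fin m}
                     (ext-a : FreeGutsExt M A a Ma) (ext-ab : FreeGutsExt Ma B b Mab)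
                     (B⊆E : B ⊆ E M) (A∩B≡⊥ : A ∩ B ≡ ⊥) where
  open ≡-Reasoning
  private
    module Ea = FreeGutsExtension M Ma ext-a
    module Eb = FreeGutsExtension Ma Mab ext-ab

  ground : E Mab ≡ (E M ∪ ⁅ a ⁆) ∪ ⁅ b ⁆
  ground = trans Eb.ground (cong (_∪ ⁅ b ⁆) Ea.ground)

  rank-neither : X ⊆ E M → r Mab X ≡ r M X
  rank-neither X⊆E = trans (Eb.rank-old (Ea.⊆-ext X⊆E)) (Ea.rank-old X⊆E)

  rank-first : X ⊆ E M → r Mab (X ∪ ⁅ a ⁆) ≡ r M X + 1 ⊓ conn M X A
  rank-first X⊆E = trans (Eb.rank-old (Ea.∪⁅e⁆⊆-ext X⊆E)) (Ea.rank-adjoin X⊆E)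

  rank-second : X ⊆ E M → r Mab (X ∪ ⁅ b ⁆) ≡ r M X + 1 ⊓ conn M X B
  rank-second {X = X} X⊆E = begin
    r Mab (X ∪ ⁅ b ⁆)         ≡⟨ Eb.rank-adjoin (Ea.⊆-ext X⊆E) ⟩
    r Ma X + 1 ⊓ conn Ma X B  ≡⟨ cong₂ (λ k l → k + 1 ⊓ l)
                                       (Ea.rank-old X⊆E) (Ea.conn-old B⊆E A∩B≡⊥ X⊆E) ⟩
    r M X + 1 ⊓ conn M X B    ∎

  rank-both : X ⊆ E M → r Mab ((X ∪ ⁅ a ⁆) ∪ ⁅ b ⁆) ≡ r M X + jointRise M X A B
  rank-both {X = X} X⊆E = begin
    r Mab ((X ∪ ⁅ a ⁆) ∪ ⁅ b ⁆)       ≡⟨ Eb.rank-adjoin (Ea.∪⁅e⁆⊆-ext X⊆E) ⟩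
    r Ma (X ∪ ⁅ a ⁆) + 1 ⊓ l          ≡⟨ cong (_+ 1 ⊓ l) (Ea.rank-adjoin X⊆E) ⟩
    r M X + 1 ⊓ conn M X A + 1 ⊓ l    ≡⟨ +-assoc (r M X) _ _ ⟩
    r M X + (1 ⊓ conn M X A + 1 ⊓ l)  ≡⟨ cong (λ g → r M X + (1 ⊓ g + 1 ⊓ l)) split-A ⟩
    r M X + (1 ⊓ (P + D) + 1 ⊓ l)     ≡⟨ cong (r M X +_) (stepwise-rise P Q D l l-step) ⟩
    r M X + jointRise M X A B         ∎
    where
    l = conn Ma (X ∪ ⁅ a ⁆) B
    P = conn M (B ∪ X) A
    Q = conn M (A ∪ X) B
    D = localConn M X A B

    split-A : conn M X A ≡ P + D
    split-A = conn-split M Ea.Z⊆E B⊆E (trans (∩-comm B A) A∩B≡⊥) X⊆E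
    split-B : conn M X B ≡ Q + D
    split-B = trans (conn-split M B⊆E Ea.Z⊆E A∩B≡⊥ X⊆E) (cong (Q +_) (localConn-comm M X B A))
    l-step : l + 1 ⊓ (P + D) ≡ Q + D + 1 ⊓ P
    l-step = subst₂ (λ g h → l + 1 ⊓ g ≡ h + 1 ⊓ P) split-A split-B
                    (Ea.conn-adjoin B⊆E A∩B≡⊥ X⊆E)

-- a ∉ E M and b ∉ E M are part of the FreeGutsExt hypotheses, and a ≢ b follows from b ∉ E Ma.
lemma3p16 : ∀ {m} (M : Matroid m) (A B : Subset m) (a b : Fin m) →
    A ⊆ E M → B ⊆ E M → A ∩ B ≡ ⊥ →
    a ∉ E M → b ∉ E M → a ≢ b →
    (Ma Mb Mab Mba : Matroid m) →
    FreeGutsExt M A a Ma → FreeGutsExt M B b Mb →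
    FreeGutsExt Ma B b Mab → FreeGutsExt Mb A a Mba →
    Mab ≈M Mba
lemma3p16 M A B a b A⊆E B⊆E A∩B≡⊥ _ _ _ Ma Mb Mab Mba ext-a ext-b ext-ab ext-ba =
  ground-eq , rank-eq
  where
  open ≡-Reasoning
  module AB = TwoExtensions M Ma Mab ext-a ext-ab B⊆E A∩B≡⊥
  module BA = TwoExtensions M Mb Mba ext-b ext-ba A⊆E (trans (∩-comm B A) A∩B≡⊥)

  ground-eq : E Mab ≡ E Mba
  ground-eq = trans AB.ground (trans ([p∪q]∪s≡[p∪s]∪q (E M) ⁅ a ⁆ ⁅ b ⁆) (sym BA.ground))

  rank-eq : ∀ X → X ⊆ E Mab → r Mab X ≡ r Mba X
  rank-eq X X⊆E′ with split (subst (X ⊆_) AB.ground X⊆E′)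
  ... | absent X⊆E∪a with split X⊆E∪a
  ...   | absent  X⊆E = trans (AB.rank-neither X⊆E) (sym (BA.rank-neither X⊆E))
  ...   | present X⊆E = trans (AB.rank-first X⊆E) (sym (BA.rank-second X⊆E))
  rank-eq _ _ | present X⊆E∪a with split X⊆E∪a
  ...   | absent  X⊆E = trans (AB.rank-second X⊆E) (sym (BA.rank-first X⊆E))
  ...   | present {X₀} X⊆E = begin
    r Mab ((X₀ ∪ ⁅ a ⁆) ∪ ⁅ b ⁆)  ≡⟨ AB.rank-both X⊆E ⟩
    r M X₀ + jointRise M X₀ A B   ≡⟨ cong (r M X₀ +_) (jointRise-comm M X₀ A B) ⟩
    r M X₀ + jointRise M X₀ B A   ≡⟨ BA.rank-both X⊆E ⟨
    r Mba ((X₀ ∪ ⁅ b ⁆) ∪ ⁅ a ⁆)  ≡⟨ cong (r Mba) ([p∪q]∪s≡[p∪s]∪q X₀ ⁅ b ⁆ ⁅ a ⁆) ⟩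
    r Mba ((X₀ ∪ ⁅ a ⁆) ∪ ⁅ b ⁆)  ∎
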